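{- For positive integers $n$ and $t$, the number of triples $(\alpha,\beta,\gamma)$ of partitions with $|\alpha|+|\beta|+|\gamma|=n$, such that $\alpha$ is a $2$-distinct partition of length $t$, $\beta$ is a strict partition of length $t$ and $\gamma$ is a partition of length at most $t$, equals the number of triples $(\mu,\nu,\omega)$ of partitions with $|\mu|+|\nu|+|\omega|=n$ such that $\mu$ is a strict partition of length $t$, $\nu$ is a strict partition of length $t$ and $\omega$ is a strict partition of length $t$ or $t-1$.
   Context: A partition is a finite weakly decreasing sequence of positive integers; its length is the number of parts and its weight $|\cdot|$ is the sum of the parts. A partition is $k$-distinct if any two adjacent parts differ by at least $k$; $1$-distinct partitions are called strict partitions. -}

module Defs where

open import Data.Nat using (ℕ; zero; suc; _+_; _≤_; _∸_; _<_)
open import Data.List using (List; length)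
open import Data.Nat.ListAction using (sum)
open import Data.List.Relation.Unary.All using (All)
open import Data.List.Relation.Unary.Linked using (Linked)
open import Data.Product using (Σ; _×_; _,_)
open import Data.Sum using (_⊎_)
open import Relation.Binary.PropositionalEquality using (_≡_)

IsPartition : List ℕ → Set
IsPartition xs = All (λ x → 1 ≤ x) xs × Linked (λ a b → b ≤ a) xs

weight : List ℕ → ℕ
weight = sum

KDistinct : ℕ → List ℕ → Set
KDistinct k xs = Linked (λ a b → b + k ≤ a) xs

Strict : List ℕ → Set
Strict = KDistinct 1

LeftTriples : ℕ → ℕ → Set
LeftTriples n t =
  Σ (List ℕ × List ℕ × List ℕ) λ { (α , β , γ) →
      (weight α + weight β + weight γ ≡ n)
    × (IsPartition α × KDistinct 2 α × length α ≡ t)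
    × (IsPartition β × Strict β × length β ≡ t)
    × (IsPartition γ × length γ ≤ t) }

RightTriples : ℕ → ℕ → Set
RightTriples n t =
  Σ (List ℕ × List ℕ × List ℕ) λ { (μ , ν , ω) →
      (weight μ + weight ν + weight ω ≡ n)
    × (IsPartition μ × Strict μ × length μ ≡ t)
    × (IsPartition ν × Strict ν × length ν ≡ t)
    × (IsPartition ω × Strict ω × (length ω ≡ t ⊎ length ω ≡ t ∸ 1)) }

-- Subtracting the staircase (t-1, ..., 1, 0) from a list of length t turns
-- (k+1)-distinct lists into k-distinct ones and lowers the weight by
-- t(t-1)/2.  Hence α ↦ α - staircase identifies 2-distinct partitions of
-- length t with strict ones of length t.  Padding γ with zeros to length t and
-- adding the staircase gives a strict list of length t whose last part may be
-- 0; dropping that zero yields a strict partition ω of length t or t - 1.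
-- Both maps raise or lower the weight by the same amount t(t-1)/2, so
-- (α, β, γ) ↦ (α - staircase, β, ω) preserves total weight and is a bijection.
module Submission where

open import Defs
open import Data.Nat using (ℕ; zero; suc; _+_; _≤_; _∸_; z≤n; s≤s)
open import Data.Nat.Properties
open import Data.Nat.Tactic.RingSolver using (solve-∀)
open import Data.List using (List; []; _∷_; length)
open import Data.Nat.ListAction using (sum)
open import Data.List.Relation.Unary.All as All using (All; []; _∷_)
open import Data.List.Relation.Unary.Linked as Linked using (Linked; []; [-]; _∷_)
open import Data.Product using (Σ; _×_; _,_; proj₁; proj₂)
open import Data.Sum using (_⊎_; inj₁; inj₂)
open import Data.Empty using (⊥-elim)
open import Relation.Nullary using (¬_)
open import Relation.Nullary.Irrelevant using (Irrelevant)
open import Relation.Binary.PropositionalEquality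
open import Function.Base using (_∘_)
open import Function.Bundles using (_↔_; mk↔ₛ′)

Positive : List ℕ → Set
Positive = All (1 ≤_)

Decreasing : List ℕ → Set
Decreasing = Linked (λ a b → b ≤ a)

distinct⇒decreasing : ∀ k {xs} → KDistinct k xs → Decreasing xs
distinct⇒decreasing k = Linked.map (λ {_} {b} r → ≤-trans (m≤m+n b k) r)

decreasing⇒0-distinct : ∀ {xs} → Decreasing xs → KDistinct 0 xs
decreasing⇒0-distinct = Linked.map (λ {a} {b} r → subst (_≤ a) (sym (+-identityʳ b)) r)

addStaircase : List ℕ → List ℕ
addStaircase [] = []
addStaircase (x ∷ xs) = (x + length xs) ∷ addStaircase xs

subStaircase : List ℕ → List ℕ
subStaircase [] = []
subStaircase (x ∷ xs) = (x ∸ length xs) ∷ subStaircase xs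

triangle : ℕ → ℕ
triangle zero = 0
triangle (suc n) = n + triangle n

length-addStaircase : ∀ xs → length (addStaircase xs) ≡ length xs
length-addStaircase [] = refl
length-addStaircase (x ∷ xs) = cong suc (length-addStaircase xs)

length-subStaircase : ∀ xs → length (subStaircase xs) ≡ length xs
length-subStaircase [] = refl
length-subStaircase (x ∷ xs) = cong suc (length-subStaircase xs)

subStaircase-addStaircase : ∀ xs → subStaircase (addStaircase xs) ≡ xs
subStaircase-addStaircase [] = refl
subStaircase-addStaircase (x ∷ xs)
  rewrite length-addStaircase xs | m+n∸n≡m x (length xs) | subStaircase-addStaircase xs = refl

length≤head : ∀ k x xs → KDistinct (suc k) (x ∷ xs) → length xs ≤ x
length≤head k x [] _ = z≤n
length≤head k x (y ∷ ys) (r ∷ l) = begin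
  suc (length ys) ≤⟨ s≤s (length≤head k y ys l) ⟩
  suc y           ≤⟨ s≤s (m≤m+n y k) ⟩
  suc (y + k)     ≡⟨ +-suc y k ⟨
  y + suc k       ≤⟨ r ⟩
  x               ∎
  where open ≤-Reasoning

addStaircase-subStaircase : ∀ k xs → KDistinct (suc k) xs → addStaircase (subStaircase xs) ≡ xs
addStaircase-subStaircase k [] _ = refl
addStaircase-subStaircase k (x ∷ xs) l
  rewrite length-subStaircase xs | m∸n+n≡m (length≤head k x xs l)
        | addStaircase-subStaircase k xs (Linked.tail l) = refl

-- The gap between adjacent parts grows by exactly one.
gap-addStaircase : ∀ y k ℓ → (y + ℓ) + suc k ≡ (y + k) + suc ℓ
gap-addStaircase = solve-∀

addStaircase-distinct : ∀ k xs → KDistinct k xs → KDistinct (suc k) (addStaircase xs)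
addStaircase-distinct k [] [] = []
addStaircase-distinct k (x ∷ []) [-] = [-]
addStaircase-distinct k (x ∷ y ∷ ys) (r ∷ l) =
  subst (_≤ x + suc (length ys)) (sym (gap-addStaircase y k (length ys)))
        (+-monoˡ-≤ (suc (length ys)) r)
  ∷ addStaircase-distinct k (y ∷ ys) l

addStaircase-distinct⁻ : ∀ k xs → KDistinct (suc k) (addStaircase xs) → KDistinct k xs
addStaircase-distinct⁻ k [] [] = []
addStaircase-distinct⁻ k (x ∷ []) [-] = [-]
addStaircase-distinct⁻ k (x ∷ y ∷ ys) (r ∷ l) =
  +-cancelʳ-≤ (suc (length ys)) (y + k) x
    (subst (_≤ x + suc (length ys)) (gap-addStaircase y k (length ys)) r)
  ∷ addStaircase-distinct⁻ k (y ∷ ys) l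

subStaircase-distinct : ∀ k xs → KDistinct (suc k) xs → KDistinct k (subStaircase xs)
subStaircase-distinct k xs l =
  addStaircase-distinct⁻ k (subStaircase xs)
    (subst (KDistinct (suc k)) (sym (addStaircase-subStaircase k xs l)) l)

sum-addStaircase : ∀ xs → sum (addStaircase xs) ≡ sum xs + triangle (length xs)
sum-addStaircase [] = refl
sum-addStaircase (x ∷ xs) rewrite sum-addStaircase xs =
  shuffle x (length xs) (sum xs) (triangle (length xs))
  where
  shuffle : ∀ x ℓ s t → x + ℓ + (s + t) ≡ (x + s) + (ℓ + t)
  shuffle = solve-∀

sum-subStaircase : ∀ k xs → KDistinct (suc k) xs →
  sum xs ≡ sum (subStaircase xs) + triangle (length xs)
sum-subStaircase k xs l = begin
  sum xs                                              ≡⟨ cong sum (addStaircase-subStaircase k xs l) ⟨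
  sum (addStaircase (subStaircase xs))                ≡⟨ sum-addStaircase (subStaircase xs) ⟩
  sum (subStaircase xs) + triangle (length (subStaircase xs))
                                                      ≡⟨ cong (λ m → sum (subStaircase xs) + triangle m)
                                                              (length-subStaircase xs) ⟩
  sum (subStaircase xs) + triangle (length xs)        ∎
  where open ≡-Reasoning

addStaircase-positive : ∀ xs → Positive xs → Positive (addStaircase xs)
addStaircase-positive [] [] = []
addStaircase-positive (x ∷ xs) (p ∷ ps) = ≤-trans p (m≤m+n x (length xs)) ∷ addStaircase-positive xs ps

-- The last part is not shifted, and it bounds all the others from below.
addStaircase-positive⁻ : ∀ xs → Decreasing xs → Positive (addStaircase xs) → Positive xs
addStaircase-positive⁻ [] _ _ = []
addStaircase-positive⁻ (x ∷ []) _ (p ∷ []) = subst (1 ≤_) (+-identityʳ x) p ∷ []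
addStaircase-positive⁻ (x ∷ y ∷ ys) (r ∷ l) (_ ∷ ps)
  with addStaircase-positive⁻ (y ∷ ys) l ps
... | q ∷ qs = ≤-trans q r ∷ q ∷ qs

addStaircase-partition : ∀ k xs → Positive xs → KDistinct k xs → IsPartition (addStaircase xs)
addStaircase-partition k xs p d =
  addStaircase-positive xs p , distinct⇒decreasing (suc k) (addStaircase-distinct k xs d)

subStaircase-partition : ∀ k xs → Positive xs → KDistinct (suc k) xs → IsPartition (subStaircase xs)
subStaircase-partition k xs p d =
  addStaircase-positive⁻ (subStaircase xs) decreasing
    (subst Positive (sym (addStaircase-subStaircase k xs d)) p) , decreasing
  where
  decreasing : Decreasing (subStaircase xs)
  decreasing = distinct⇒decreasing k (subStaircase-distinct k xs d)

padZeros : ℕ → List ℕ → List ℕ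
padZeros zero xs = xs
padZeros (suc t) [] = 0 ∷ padZeros t []
padZeros (suc t) (x ∷ xs) = x ∷ padZeros t xs

dropZeros : List ℕ → List ℕ
dropZeros [] = []
dropZeros (zero ∷ xs) = []
dropZeros (suc x ∷ xs) = suc x ∷ dropZeros xs

length-padZeros : ∀ t xs → length xs ≤ t → length (padZeros t xs) ≡ t
length-padZeros zero [] _ = refl
length-padZeros (suc t) [] _ = cong suc (length-padZeros t [] z≤n)
length-padZeros (suc t) (x ∷ xs) (s≤s p) = cong suc (length-padZeros t xs p)

sum-padZeros : ∀ t xs → sum (padZeros t xs) ≡ sum xs
sum-padZeros zero xs = refl
sum-padZeros (suc t) [] = sum-padZeros t []
sum-padZeros (suc t) (x ∷ xs) = cong (x +_) (sum-padZeros t xs)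

padZeros-decreasing : ∀ t xs → Decreasing xs → Decreasing (padZeros t xs)
padZeros-decreasing zero xs l = l
padZeros-decreasing (suc zero) [] _ = [-]
padZeros-decreasing (suc (suc t)) [] _ = z≤n ∷ padZeros-decreasing (suc t) [] []
padZeros-decreasing (suc zero) (x ∷ xs) l = l
padZeros-decreasing (suc (suc t)) (x ∷ []) _ = z≤n ∷ padZeros-decreasing (suc t) [] []
padZeros-decreasing (suc (suc t)) (x ∷ y ∷ ys) (r ∷ l) = r ∷ padZeros-decreasing (suc t) (y ∷ ys) l

-- At most one zero can be appended to a strict partition.
padZeros-strict : ∀ t xs → Positive xs → Strict xs → t ≤ suc (length xs) → Strict (padZeros t xs)
padZeros-strict zero xs _ s _ = s
padZeros-strict (suc zero) [] _ _ _ = [-]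
padZeros-strict (suc zero) (x ∷ xs) _ s _ = s
padZeros-strict (suc (suc t)) [] _ _ (s≤s ())
padZeros-strict (suc (suc zero)) (x ∷ []) (p ∷ _) _ _ = p ∷ [-]
padZeros-strict (suc (suc (suc t))) (x ∷ []) _ _ (s≤s (s≤s ()))
padZeros-strict (suc (suc t)) (x ∷ y ∷ ys) (_ ∷ ps) (r ∷ s) (s≤s t≤) =
  r ∷ padZeros-strict (suc t) (y ∷ ys) ps s t≤

dropZeros-positive : ∀ xs → Positive (dropZeros xs)
dropZeros-positive [] = []
dropZeros-positive (zero ∷ _) = []
dropZeros-positive (suc x ∷ xs) = s≤s z≤n ∷ dropZeros-positive xs

dropZeros-linked : ∀ {R : ℕ → ℕ → Set} xs → Linked R xs → Linked R (dropZeros xs)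
dropZeros-linked [] _ = []
dropZeros-linked (zero ∷ _) _ = []
dropZeros-linked (suc x ∷ []) _ = [-]
dropZeros-linked (suc x ∷ zero ∷ _) _ = [-]
dropZeros-linked (suc x ∷ suc y ∷ ys) (r ∷ l) = r ∷ dropZeros-linked (suc y ∷ ys) l

length-dropZeros≤ : ∀ xs → length (dropZeros xs) ≤ length xs
length-dropZeros≤ [] = z≤n
length-dropZeros≤ (zero ∷ _) = z≤n
length-dropZeros≤ (suc x ∷ xs) = s≤s (length-dropZeros≤ xs)

length-dropZeros-strict : ∀ xs → Strict xs →
  length (dropZeros xs) ≡ length xs ⊎ length (dropZeros xs) ≡ length xs ∸ 1
length-dropZeros-strict [] _ = inj₁ refl
length-dropZeros-strict (zero ∷ []) _ = inj₂ refl
length-dropZeros-strict (zero ∷ y ∷ _) (r ∷ _) = ⊥-elim (1+n≢0 (trans (+-comm 1 y) (n≤0⇒n≡0 r)))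
length-dropZeros-strict (suc x ∷ []) _ = inj₁ refl
length-dropZeros-strict (suc x ∷ y ∷ ys) (_ ∷ l) with length-dropZeros-strict (y ∷ ys) l
... | inj₁ e = inj₁ (cong suc e)
... | inj₂ e = inj₂ (cong suc e)

dropZeros-padZeros : ∀ t xs → Positive xs → dropZeros (padZeros t xs) ≡ xs
dropZeros-padZeros zero [] _ = refl
dropZeros-padZeros (suc t) [] _ = refl
dropZeros-padZeros t (suc x ∷ xs) (_ ∷ ps) with t
... | zero   = cong (suc x ∷_) (dropZeros-padZeros 0 xs ps)
... | suc t′ = cong (suc x ∷_) (dropZeros-padZeros t′ xs ps)

padZeros-dropZeros : ∀ xs → Decreasing xs → padZeros (length xs) (dropZeros xs) ≡ xs
padZeros-dropZeros [] _ = refl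
padZeros-dropZeros (zero ∷ xs) l = cong (0 ∷_) (zeros xs l)
  where
  zeros : ∀ ys → Decreasing (0 ∷ ys) → padZeros (length ys) [] ≡ ys
  zeros [] _ = refl
  zeros (zero ∷ ys) (z≤n ∷ l) = cong (0 ∷_) (zeros ys l)
padZeros-dropZeros (suc x ∷ xs) l = cong (suc x ∷_) (padZeros-dropZeros xs (Linked.tail l))

sum-dropZeros : ∀ xs → Decreasing xs → sum (dropZeros xs) ≡ sum xs
sum-dropZeros xs l =
  trans (sym (sum-padZeros (length xs) (dropZeros xs))) (cong sum (padZeros-dropZeros xs l))

partition→strict : ℕ → List ℕ → List ℕ
partition→strict t γ = dropZeros (addStaircase (padZeros t γ))

strict→partition : ℕ → List ℕ → List ℕ
strict→partition t ω = dropZeros (subStaircase (padZeros t ω))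

module _ (t : ℕ) {γ : List ℕ} (γ-partition : IsPartition γ) (γ-length : length γ ≤ t) where

  private
    padded raised : List ℕ
    padded = padZeros t γ
    raised = addStaircase padded

    raised-strict : Strict raised
    raised-strict = addStaircase-distinct 0 padded
      (decreasing⇒0-distinct (padZeros-decreasing t γ (proj₂ γ-partition)))

    raised-length : length raised ≡ t
    raised-length = trans (length-addStaircase padded) (length-padZeros t γ γ-length)

  partition→strict-strictPartition :
    IsPartition (partition→strict t γ) × Strict (partition→strict t γ)
    × (length (partition→strict t γ) ≡ t ⊎ length (partition→strict t γ) ≡ t ∸ 1)
  partition→strict-strictPartition =
    (dropZeros-positive raised , distinct⇒decreasing 1 strict) , strict , shortened
    where
    strict : Strict (dropZeros raised)
    strict = dropZeros-linked raised raised-strict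
    shortened : length (dropZeros raised) ≡ t ⊎ length (dropZeros raised) ≡ t ∸ 1
    shortened with length-dropZeros-strict raised raised-strict
    ... | inj₁ e = inj₁ (trans e raised-length)
    ... | inj₂ e = inj₂ (trans e (cong (_∸ 1) raised-length))

  sum-partition→strict : sum (partition→strict t γ) ≡ sum γ + triangle t
  sum-partition→strict = begin
    sum (dropZeros raised)          ≡⟨ sum-dropZeros raised (distinct⇒decreasing 1 raised-strict) ⟩
    sum raised                      ≡⟨ sum-addStaircase padded ⟩
    sum padded + triangle (length padded)
                                    ≡⟨ cong₂ (λ a m → a + triangle m) (sum-padZeros t γ)
                                             (length-padZeros t γ γ-length) ⟩
    sum γ + triangle t              ∎
    where open ≡-Reasoning

  strict→partition-partition→strict : strict→partition t (partition→strict t γ) ≡ γ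
  strict→partition-partition→strict = begin
    dropZeros (subStaircase (padZeros t (dropZeros raised)))
      ≡⟨ cong (λ m → dropZeros (subStaircase (padZeros m (dropZeros raised)))) raised-length ⟨
    dropZeros (subStaircase (padZeros (length raised) (dropZeros raised)))
      ≡⟨ cong (dropZeros ∘ subStaircase) (padZeros-dropZeros raised (distinct⇒decreasing 1 raised-strict)) ⟩
    dropZeros (subStaircase raised)
      ≡⟨ cong dropZeros (subStaircase-addStaircase padded) ⟩
    dropZeros padded
      ≡⟨ dropZeros-padZeros t γ (proj₁ γ-partition) ⟩
    γ ∎
    where
    open ≡-Reasoning

module _ (t : ℕ) {ω : List ℕ} (ω-partition : IsPartition ω) (ω-strict : Strict ω)
         (ω-short : length ω ≤ t) (ω-long : t ≤ suc (length ω)) where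

  private
    padded lowered : List ℕ
    padded = padZeros t ω
    lowered = subStaircase padded

    padded-strict : Strict padded
    padded-strict = padZeros-strict t ω (proj₁ ω-partition) ω-strict ω-long

    padded-length : length padded ≡ t
    padded-length = length-padZeros t ω ω-short

    lowered-decreasing : Decreasing lowered
    lowered-decreasing = distinct⇒decreasing 0 (subStaircase-distinct 0 padded padded-strict)

    lowered-length : length lowered ≡ t
    lowered-length = trans (length-subStaircase padded) padded-length

  strict→partition-partition : IsPartition (strict→partition t ω)
  strict→partition-partition =
    dropZeros-positive lowered , dropZeros-linked lowered lowered-decreasing

  strict→partition-length : length (strict→partition t ω) ≤ t
  strict→partition-length = ≤-trans (length-dropZeros≤ lowered) (≤-reflexive lowered-length)

  sum-strict→partition : sum ω ≡ sum (strict→partition t ω) + triangle t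
  sum-strict→partition = begin
    sum ω                         ≡⟨ sum-padZeros t ω ⟨
    sum padded                    ≡⟨ sum-subStaircase 0 padded padded-strict ⟩
    sum lowered + triangle (length padded)
                                  ≡⟨ cong₂ (λ a m → a + triangle m)
                                           (sym (sum-dropZeros lowered lowered-decreasing)) padded-length ⟩
    sum (dropZeros lowered) + triangle t ∎
    where open ≡-Reasoning

  partition→strict-strict→partition : partition→strict t (strict→partition t ω) ≡ ω
  partition→strict-strict→partition = begin
    dropZeros (addStaircase (padZeros t (dropZeros lowered)))
      ≡⟨ cong (λ m → dropZeros (addStaircase (padZeros m (dropZeros lowered)))) lowered-length ⟨
    dropZeros (addStaircase (padZeros (length lowered) (dropZeros lowered)))
      ≡⟨ cong (dropZeros ∘ addStaircase) (padZeros-dropZeros lowered lowered-decreasing) ⟩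
    dropZeros (addStaircase lowered)
      ≡⟨ cong dropZeros (addStaircase-subStaircase 0 padded padded-strict) ⟩
    dropZeros padded
      ≡⟨ dropZeros-padZeros t ω (proj₁ ω-partition) ⟩
    ω ∎
    where open ≡-Reasoning

×-irrelevant : ∀ {A B : Set} → Irrelevant A → Irrelevant B → Irrelevant (A × B)
×-irrelevant irrA irrB (a , b) (a′ , b′) = cong₂ _,_ (irrA a a′) (irrB b b′)

⊎-irrelevant : ∀ {A B : Set} → Irrelevant A → Irrelevant B → (A → ¬ B) → Irrelevant (A ⊎ B)
⊎-irrelevant irrA _ _ (inj₁ a) (inj₁ a′) = cong inj₁ (irrA a a′)
⊎-irrelevant _ irrB _ (inj₂ b) (inj₂ b′) = cong inj₂ (irrB b b′)
⊎-irrelevant _ _ disjoint (inj₁ a) (inj₂ b) = ⊥-elim (disjoint a b)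
⊎-irrelevant _ _ disjoint (inj₂ b) (inj₁ a) = ⊥-elim (disjoint a b)

isPartition-irrelevant : ∀ {xs} → Irrelevant (IsPartition xs)
isPartition-irrelevant = ×-irrelevant (All.irrelevant ≤-irrelevant) (Linked.irrelevant ≤-irrelevant)

distinctPartition-irrelevant : ∀ k {xs} {A : Set} → Irrelevant A →
  Irrelevant (IsPartition xs × KDistinct k xs × A)
distinctPartition-irrelevant k =
  ×-irrelevant isPartition-irrelevant ∘ ×-irrelevant (Linked.irrelevant ≤-irrelevant)

Σ-≡-irrelevant : ∀ {A : Set} {P : A → Set} → (∀ {x} → Irrelevant (P x)) →
  {u v : Σ A P} → proj₁ u ≡ proj₁ v → u ≡ v
Σ-≡-irrelevant irr {x , p} {.x , q} refl = cong (x ,_) (irr p q)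

leftTriples-≡ : ∀ {n t} {u v : LeftTriples n t} → proj₁ u ≡ proj₁ v → u ≡ v
leftTriples-≡ = Σ-≡-irrelevant λ { {_ , _ , _} →
  ×-irrelevant ≡-irrelevant
    (×-irrelevant (distinctPartition-irrelevant 2 ≡-irrelevant)
      (×-irrelevant (distinctPartition-irrelevant 1 ≡-irrelevant)
        (×-irrelevant isPartition-irrelevant ≤-irrelevant))) }

-- For t = 0 both length conditions on ω hold at once, so this fails.
rightTriples-≡ : ∀ {n t} {u v : RightTriples n (suc t)} → proj₁ u ≡ proj₁ v → u ≡ v
rightTriples-≡ = Σ-≡-irrelevant λ { {_ , _ , _} →
  ×-irrelevant ≡-irrelevant
    (×-irrelevant (distinctPartition-irrelevant 1 ≡-irrelevant)
      (×-irrelevant (distinctPartition-irrelevant 1 ≡-irrelevant)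
        (distinctPartition-irrelevant 1
          (⊎-irrelevant ≡-irrelevant ≡-irrelevant (λ e e′ → 1+n≢n (trans (sym e) e′)))))) }

weight-transfer : ∀ {a a′ b c c′ d} → a ≡ a′ + d → c′ ≡ c + d → a + b + c ≡ a′ + b + c′
weight-transfer {a′ = a′} {b} {c} {d = d} refl refl = shuffle a′ b c d
  where
  shuffle : ∀ a′ b c d → a′ + d + b + c ≡ a′ + b + (c + d)
  shuffle = solve-∀

length-bounds : ∀ {ℓ t} → ℓ ≡ suc t ⊎ ℓ ≡ t → ℓ ≤ suc t × suc t ≤ suc ℓ
length-bounds {t = t} (inj₁ refl) = ≤-refl , n≤1+n (suc t)
length-bounds {t = t} (inj₂ refl) = n≤1+n t , ≤-refl

module _ (n t : ℕ) where

  to : LeftTriples n (suc t) → RightTriples n (suc t)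
  to ((α , β , γ) , w , (α-partition , α-distinct , α-length) , β-conditions , (γ-partition , γ-length)) =
    (subStaircase α , β , partition→strict (suc t) γ) , w′ ,
    (subStaircase-partition 1 α (proj₁ α-partition) α-distinct ,
     subStaircase-distinct 1 α α-distinct , trans (length-subStaircase α) α-length) ,
    β-conditions , partition→strict-strictPartition (suc t) γ-partition γ-length
    where
    α-weight : sum α ≡ sum (subStaircase α) + triangle (suc t)
    α-weight = trans (sum-subStaircase 1 α α-distinct)
                     (cong (λ m → sum (subStaircase α) + triangle m) α-length)
    w′ : sum (subStaircase α) + sum β + sum (partition→strict (suc t) γ) ≡ n
    w′ = trans (sym (weight-transfer α-weight (sum-partition→strict (suc t) γ-partition γ-length))) w

  from : RightTriples n (suc t) → LeftTriples n (suc t)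
  from ((μ , ν , ω) , w , (μ-partition , μ-strict , μ-length) , ν-conditions , (ω-partition , ω-strict , ω-length)) =
    (addStaircase μ , ν , strict→partition (suc t) ω) , w′ ,
    (addStaircase-partition 1 μ (proj₁ μ-partition) μ-strict ,
     addStaircase-distinct 1 μ μ-strict , trans (length-addStaircase μ) μ-length) ,
    ν-conditions ,
    (strict→partition-partition (suc t) ω-partition ω-strict short long ,
     strict→partition-length (suc t) ω-partition ω-strict short long)
    where
    short : length ω ≤ suc t
    short = proj₁ (length-bounds ω-length)
    long : suc t ≤ suc (length ω)
    long = proj₂ (length-bounds ω-length)
    μ-weight : sum (addStaircase μ) ≡ sum μ + triangle (suc t)
    μ-weight = trans (sum-addStaircase μ) (cong (λ m → sum μ + triangle m) μ-length)
    w′ : sum (addStaircase μ) + sum ν + sum (strict→partition (suc t) ω) ≡ n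
    w′ = trans (weight-transfer μ-weight (sum-strict→partition (suc t) ω-partition ω-strict short long)) w

  from∘to : ∀ x → from (to x) ≡ x
  from∘to ((α , β , γ) , _ , (_ , α-distinct , _) , _ , (γ-partition , γ-length)) =
    leftTriples-≡ (cong₂ (λ a c → a , β , c)
      (addStaircase-subStaircase 1 α α-distinct)
      (strict→partition-partition→strict (suc t) γ-partition γ-length))

  to∘from : ∀ x → to (from x) ≡ x
  to∘from ((μ , ν , ω) , _ , _ , _ , (ω-partition , ω-strict , ω-length)) =
    rightTriples-≡ (cong₂ (λ a c → a , ν , c)
      (subStaircase-addStaircase μ)
      (partition→strict-strict→partition (suc t) ω-partition ω-strict
        (proj₁ (length-bounds ω-length)) (proj₂ (length-bounds ω-length))))

-- The bijection preserves weight for every n.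
lemma1 : (n t : ℕ) → 1 ≤ n → 1 ≤ t → LeftTriples n t ↔ RightTriples n t
lemma1 n zero _ ()
lemma1 n (suc t) _ _ = mk↔ₛ′ (to n t) (from n t) (to∘from n t) (from∘to n t)
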